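{- Let $\mathcal L$ be a uniform semimodular lattice, let $x=e^0\prec e^1\prec\cdots\prec e^s$ be an $x$-segment, and let $p\succeq x$ satisfy $p\wedge e^1=x$. Then the chain $p=p\vee e^0\prec p\vee e^1\prec\cdots\prec p\vee e^s$ is a $p$-segment.
   Context: Lattices satisfy (F): no interval contains a chain of infinite length. $x\prec_1y$: $y$ covers $x$. Semimodular: $x\wedge a\prec_1a$ implies $x\prec_1x\vee a$. Ascending operator $(x)^+:=\bigvee\{y: y\text{ covers }x\}$; a uniform semimodular lattice is a semimodular lattice in which $(x)^+$ exists for all $x$ and $(\cdot)^+$ is an automorphism. A segment is a chain $e^0\prec\cdots\prec e^s$ such that $e^\ell$ covers $e^{\ell-1}$ ($1\le\ell\le s$) and $e^{\ell+1}\notin[e^{\ell-1},(e^{\ell-1})^+]$ ($1\le\ell\le s-1$); it is an $x$-segment if $e^0=x$. -}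

module Defs where

open import Level using (Level; _⊔_)
open import Data.Nat using (ℕ; zero; suc) renaming (_<_ to _<ℕ_; _≤_ to _≤ℕ_)
open import Data.Product using (Σ; ∃; _×_; _,_)
open import Data.Sum using (_⊎_)
open import Relation.Nullary using (¬_)
open import Relation.Binary.PropositionalEquality using (_≡_)
open import Relation.Binary.Lattice.Bundles using (Lattice)

module LatticeNotions {c ℓ₁ ℓ₂ : Level} (L : Lattice c ℓ₁ ℓ₂) where
  open Lattice L

  _<ₗ_ : Carrier → Carrier → Set (ℓ₁ ⊔ ℓ₂)
  x <ₗ y = (x ≤ y) × ¬ (x ≈ y)

  _≺₁_ : Carrier → Carrier → Set (c ⊔ ℓ₁ ⊔ ℓ₂)
  x ≺₁ y = (x <ₗ y) × (∀ z → ¬ ((x <ₗ z) × (z <ₗ y)))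

  _∈[_,_] : Carrier → Carrier → Carrier → Set ℓ₂
  z ∈[ a , b ] = (a ≤ z) × (z ≤ b)

  ConditionF : Set (c ⊔ ℓ₁ ⊔ ℓ₂)
  ConditionF = ∀ (a b : Carrier) (f : ℕ → Carrier) →
    ¬ ( (∀ i → f i ∈[ a , b ])
      × (∀ i j → f i ≈ f j → i ≡ j)
      × (∀ i j → (f i ≤ f j) ⊎ (f j ≤ f i)) )

  Semimodular : Set (c ⊔ ℓ₁ ⊔ ℓ₂)
  Semimodular = ∀ x a → (x ∧ a) ≺₁ a → x ≺₁ (x ∨ a)

  IsJoinOfCovers : Carrier → Carrier → Set (c ⊔ ℓ₁ ⊔ ℓ₂)
  IsJoinOfCovers x u =
    (∀ y → x ≺₁ y → y ≤ u) × (∀ u′ → (∀ y → x ≺₁ y → y ≤ u′) → u ≤ u′)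

  IsAutomorphism : (Carrier → Carrier) → Set (c ⊔ ℓ₁)
  IsAutomorphism φ =
      (∀ x y → x ≈ y → φ x ≈ φ y)
    × (∀ x y → φ (x ∨ y) ≈ (φ x ∨ φ y))
    × (∀ x y → φ (x ∧ y) ≈ (φ x ∧ φ y))
    × (∀ x y → φ x ≈ φ y → x ≈ y)
    × (∀ y → ∃ λ x → φ x ≈ y)

record UniformSemimodular {c ℓ₁ ℓ₂ : Level} (L : Lattice c ℓ₁ ℓ₂) : Set (c ⊔ ℓ₁ ⊔ ℓ₂) where
  open Lattice L
  open LatticeNotions L
  field
    condF        : ConditionF
    semimodular  : Semimodular
    _⁺           : Carrier → Carrier
    ⁺-isJoin     : ∀ x → IsJoinOfCovers x (x ⁺)
    ⁺-automorph  : IsAutomorphism _⁺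

  -- e 0 ≺ e 1 ≺ ⋯ ≺ e s is a segment (entries of e beyond index s are ignored):
  -- e (ℓ+1) covers e ℓ for ℓ < s, and e (ℓ+2) ∉ [e ℓ , (e ℓ)⁺] for ℓ + 2 ≤ s.
  IsSegment : (s : ℕ) → (ℕ → Carrier) → Set (c ⊔ ℓ₁ ⊔ ℓ₂)
  IsSegment s e =
      (∀ ℓ → ℓ <ℕ s → e ℓ ≺₁ e (suc ℓ))
    × (∀ ℓ → suc (suc ℓ) ≤ℕ s → ¬ (e (suc (suc ℓ)) ∈[ e ℓ , e ℓ ⁺ ]))

  IsSegmentFrom : Carrier → (s : ℕ) → (ℕ → Carrier) → Set (c ⊔ ℓ₁ ⊔ ℓ₂)
  IsSegmentFrom x s e = (e 0 ≈ x) × IsSegment s e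

module Submission where

-- The proof rests on the invariant
--     q ℓ ∧ e (ℓ+1) = e ℓ                                            (I ℓ)
-- which holds for ℓ = 0 by hypothesis.  Three general facts drive it:
--  * lifting a cover: if q ∧ a = b and b ≺ a, then q ≺ q ∨ a (semimodularity);
--    with q ℓ ∨ e (ℓ+1) = q (ℓ+1) this gives the covers of the new chain;
--  * bounding by the ascent: since (·)⁺ preserves meets, an element below both
--    q⁺ and a⁺ lies below (q ∧ a)⁺; so if q ∧ e1 = x, an element e2 ≤ e1⁺ with
--    e2 ≤ q⁺ lies in [x , x⁺]; for a segment this is excluded, which yields the
--    non-membership condition of the new chain and drives the induction step;
--  * a cover has no interior: if a ≺ b and a ≤ m ≤ b with m ≠ b then m = a.
-- In the induction step m = q (ℓ+1) ∧ e (ℓ+2) lies in [e (ℓ+1), e (ℓ+2)], and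
-- m = e (ℓ+2) would put e (ℓ+2) in [e ℓ , (e ℓ)⁺]; hence m = e (ℓ+1).  The last
-- step only gives ¬ ¬ (m ≈ e (ℓ+1)) constructively, so the invariant is carried
-- in double-negated form; every conclusion drawn from it is negative or a cover
-- (whose non-trivial parts are negative), so nothing is lost.

open import Defs
open import Level using (Level)
open import Data.Nat using (ℕ; zero; suc) renaming (_≤_ to _≤ℕ_)
open import Data.Nat.Properties using (<⇒≤)
open import Data.Product using (_,_; proj₁; proj₂)
open import Relation.Nullary.Negation.Core using (¬_; ¬¬-map)
open import Relation.Binary.Lattice.Bundles using (Lattice)
import Relation.Binary.Lattice.Properties.JoinSemilattice as JoinProperties
import Relation.Binary.Lattice.Properties.MeetSemilattice as MeetProperties
import Relation.Binary.Reasoning.PartialOrder as PosetReasoning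

module SegmentTransfer {c ℓ₁ ℓ₂ : Level} (L : Lattice c ℓ₁ ℓ₂)
                       (U : UniformSemimodular L) where
  open Lattice L
  open UniformSemimodular U
  open LatticeNotions L
  open JoinProperties joinSemilattice using (∨-comm; x≤y⇒x∨y≈y)
  open MeetProperties meetSemilattice using (∧-cong)
  open PosetReasoning poset

  cover⇒≤ : ∀ {a b} → a ≺₁ b → a ≤ b
  cover⇒≤ a≺b = proj₁ (proj₁ a≺b)

  cover⇒≤⁺ : ∀ {a b} → a ≺₁ b → b ≤ a ⁺
  cover⇒≤⁺ {a} {b} a≺b = proj₁ (⁺-isJoin a) b a≺b

  ≺₁-respˡ : ∀ {a a′ b} → a ≈ a′ → a ≺₁ b → a′ ≺₁ b
  ≺₁-respˡ a≈a′ ((a≤b , a≉b) , empty) =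
      (trans (reflexive (Eq.sym a≈a′)) a≤b , λ a′≈b → a≉b (Eq.trans a≈a′ a′≈b))
    , λ z ((a′≤z , a′≉z) , z<b) →
        empty z ((trans (reflexive a≈a′) a′≤z , λ a≈z → a′≉z (Eq.trans (Eq.sym a≈a′) a≈z)) , z<b)

  ≺₁-respʳ : ∀ {a b b′} → b ≈ b′ → a ≺₁ b → a ≺₁ b′
  ≺₁-respʳ b≈b′ ((a≤b , a≉b) , empty) =
      (trans a≤b (reflexive b≈b′) , λ a≈b′ → a≉b (Eq.trans a≈b′ (Eq.sym b≈b′)))
    , λ z (a<z , (z≤b′ , z≉b′)) →
        empty z (a<z , (trans z≤b′ (reflexive (Eq.sym b≈b′)) , λ z≈b → z≉b′ (Eq.trans z≈b b≈b′)))

  -- Apart from a ≤ b, being a cover is a negative statement, hence ¬¬-stable.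
  ≺₁-stable : ∀ {a b} → a ≤ b → ¬ ¬ (a ≺₁ b) → a ≺₁ b
  ≺₁-stable a≤b ¬¬a≺b =
      (a≤b , λ a≈b → ¬¬a≺b (λ a≺b → proj₂ (proj₁ a≺b) a≈b))
    , λ z a<z<b → ¬¬a≺b (λ a≺b → proj₂ a≺b z a<z<b)

  cover-bottom : ∀ {a b m} → a ≺₁ b → m ∈[ a , b ] → ¬ (m ≈ b) → ¬ ¬ (m ≈ a)
  cover-bottom a≺b (a≤m , m≤b) m≉b m≉a =
    proj₂ a≺b _ ((a≤m , λ a≈m → m≉a (Eq.sym a≈m)) , (m≤b , m≉b))

  cover-lift : ∀ {q a b} → ¬ ¬ ((q ∧ a) ≈ b) → b ≺₁ a → q ≺₁ (q ∨ a)
  cover-lift q∧a≈b b≺a = semimodular _ _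
    (≺₁-stable (x∧y≤y _ _) (¬¬-map (λ q∧a≈b → ≺₁-respˡ (Eq.sym q∧a≈b) b≺a) q∧a≈b))

  below-ascent-of-meet : ∀ {q a b z} → z ≤ q ⁺ → z ≤ a ⁺ → (q ∧ a) ≈ b → z ≤ b ⁺
  below-ascent-of-meet {q} {a} {b} {z} z≤q⁺ z≤a⁺ q∧a≈b = begin
    z             ≤⟨ ∧-greatest z≤q⁺ z≤a⁺ ⟩
    q ⁺ ∧ a ⁺     ≈⟨ Eq.sym (⁺-∧ q a) ⟩
    (q ∧ a) ⁺     ≈⟨ ⁺-cong (q ∧ a) b q∧a≈b ⟩
    b ⁺           ∎
    where
    ⁺-cong : ∀ u v → u ≈ v → u ⁺ ≈ v ⁺
    ⁺-cong = proj₁ ⁺-automorph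

    ⁺-∧ : ∀ u v → (u ∧ v) ⁺ ≈ (u ⁺ ∧ v ⁺)
    ⁺-∧ = proj₁ (proj₂ (proj₂ ⁺-automorph))

  segment-step-avoids : ∀ {q x e1 e2} → ¬ ¬ ((q ∧ e1) ≈ x) → x ≺₁ e1 → e1 ≺₁ e2 →
                        ¬ (e2 ∈[ x , x ⁺ ]) → ¬ (e2 ≤ q ⁺)
  segment-step-avoids q∧e1≈x x≺e1 e1≺e2 e2∉ e2≤q⁺ = q∧e1≈x λ q∧e1≈x →
    e2∉ ( trans (cover⇒≤ x≺e1) (cover⇒≤ e1≺e2)
        , below-ascent-of-meet e2≤q⁺ (cover⇒≤⁺ e1≺e2) q∧e1≈x)

  invariant-step : ∀ {q x e1 e2} → ¬ ¬ ((q ∧ e1) ≈ x) → x ≺₁ e1 → e1 ≺₁ e2 →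
                   ¬ (e2 ∈[ x , x ⁺ ]) → ¬ ¬ (((q ∨ e1) ∧ e2) ≈ e1)
  invariant-step {q} {x} {e1} {e2} q∧e1≈x x≺e1 e1≺e2 e2∉ =
    cover-bottom e1≺e2 (∧-greatest (y≤x∨y _ _) (cover⇒≤ e1≺e2) , x∧y≤y _ _) m≉e2
    where
    m≉e2 : ¬ (((q ∨ e1) ∧ e2) ≈ e2)
    m≉e2 m≈e2 = segment-step-avoids q∧e1≈x x≺e1 e1≺e2 e2∉
      (trans (reflexive (Eq.sym m≈e2))
        (trans (x∧y≤x _ _) (cover⇒≤⁺ (cover-lift q∧e1≈x x≺e1))))

  module Joined (x p : Carrier) (s : ℕ) (e : ℕ → Carrier)
                (seg : IsSegmentFrom x s e) (x≤p : x ≤ p) (p∧e1≈x : (p ∧ e 1) ≈ x) where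
    e0≈x : e 0 ≈ x
    e0≈x = proj₁ seg

    covers : ∀ ℓ → suc ℓ ≤ℕ s → e ℓ ≺₁ e (suc ℓ)
    covers = proj₁ (proj₂ seg)

    avoids : ∀ ℓ → suc (suc ℓ) ≤ℕ s → ¬ (e (suc (suc ℓ)) ∈[ e ℓ , e ℓ ⁺ ])
    avoids = proj₂ (proj₂ seg)

    q : ℕ → Carrier
    q i = p ∨ e i

    q0≈p : q 0 ≈ p
    q0≈p = Eq.trans (∨-comm p (e 0)) (x≤y⇒x∨y≈y (trans (reflexive e0≈x) x≤p))

    q-succ : ∀ ℓ → suc ℓ ≤ℕ s → (q ℓ ∨ e (suc ℓ)) ≈ q (suc ℓ)
    q-succ ℓ ℓ<s = antisym
      (∨-least (∨-least (x≤x∨y _ _) (trans (cover⇒≤ (covers ℓ ℓ<s)) (y≤x∨y _ _))) (y≤x∨y _ _))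
      (∨-least (trans (x≤x∨y _ _) (x≤x∨y _ _)) (y≤x∨y _ _))

    invariant : ∀ ℓ → suc ℓ ≤ℕ s → ¬ ¬ ((q ℓ ∧ e (suc ℓ)) ≈ e ℓ)
    invariant zero    _ q0∧e1≉e0 = q0∧e1≉e0 (Eq.trans (∧-cong q0≈p Eq.refl) (Eq.trans p∧e1≈x (Eq.sym e0≈x)))
    invariant (suc ℓ) ℓ+2≤s = ¬¬-map
      (Eq.trans (∧-cong (Eq.sym (q-succ ℓ (<⇒≤ ℓ+2≤s))) Eq.refl))
      (invariant-step (invariant ℓ (<⇒≤ ℓ+2≤s))
        (covers ℓ (<⇒≤ ℓ+2≤s)) (covers (suc ℓ) ℓ+2≤s) (avoids ℓ ℓ+2≤s))

    q-segment : IsSegmentFrom p s q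
    q-segment = q0≈p , q-covers , q-avoids
      where
      q-covers : ∀ ℓ → suc ℓ ≤ℕ s → q ℓ ≺₁ q (suc ℓ)
      q-covers ℓ ℓ<s = ≺₁-respʳ (q-succ ℓ ℓ<s) (cover-lift (invariant ℓ ℓ<s) (covers ℓ ℓ<s))

      q-avoids : ∀ ℓ → suc (suc ℓ) ≤ℕ s → ¬ (q (suc (suc ℓ)) ∈[ q ℓ , q ℓ ⁺ ])
      q-avoids ℓ ℓ+2≤s (_ , q[ℓ+2]≤q[ℓ]⁺) =
        segment-step-avoids (invariant ℓ (<⇒≤ ℓ+2≤s))
          (covers ℓ (<⇒≤ ℓ+2≤s)) (covers (suc ℓ) ℓ+2≤s) (avoids ℓ ℓ+2≤s)
          (trans (y≤x∨y _ _) q[ℓ+2]≤q[ℓ]⁺)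

lemma4p6 : ∀ {c ℓ₁ ℓ₂ : Level} (L : Lattice c ℓ₁ ℓ₂) (U : UniformSemimodular L) →
    let open Lattice L in
    let open UniformSemimodular U in
    ∀ (x p : Carrier) (s : ℕ) (e : ℕ → Carrier) →
      IsSegmentFrom x s e → x ≤ p → (p ∧ e 1) ≈ x →
      IsSegmentFrom p s (λ i → p ∨ e i)
lemma4p6 L U = SegmentTransfer.Joined.q-segment L U
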